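{- Let $s$ be a state of an open shop system that is subset-reachable from the initial state $0$. Define the state $t$ by $M^t(J_j)=M^s(J_j)$ and $\mathcal{M}^t(J_j)=\mathcal{M}(J_j)\setminus(\mathcal{M}^s(J_j)\cup\{M^s(J_j)\})$ for all jobs $J_j$. Then $s$ is reachable (from $0$) if and only if $t$ is safe in the reversed system, i.e. in the system in which the roles of the artificial machines $M_0$ and $M_{m+1}$ are interchanged (a job with empty remaining set not on $M_0$ may move to $M_0$, and safe means that the state in which every job sits on $M_0$ with empty remaining set is reachable from $t$).
   Context: An open shop system consists of $n$ jobs $J_1,\ldots,J_n$ and $m$ machines $M_1,\ldots,M_m$. Each job $J_j$ has a set $\mathcal{M}(J_j)\subseteq\{M_1,\ldots,M_m\}$ of machines on which it must be processed, in an arbitrary order; each machine $M_i$ has a positive integer capacity $\mathrm{cap}(M_i)$. There are two artificial machines $M_0$ and $M_{m+1}$ of unbounded capacity. A state $s$ specifies for every job $J_j$ a machine $M^s(J_j)\in\{M_0,\ldots,M_{m+1}\}$ on which it currently sits and a set $\mathcal{M}^s(J_j)$ of machines (not containing $M^s(J_j)$) on which it still needs processing; each machine $M_i$, $1\le i\le m$, holds at most $\mathrm{cap}(M_i)$ jobs. The initial state $0$ has $M^0(J_j)=M_0$, $\mathcal{M}^0(J_j)=\mathcal{M}(J_j)$ for all $j$. A successor of $s$ arises by moving a single job $J_j$ from $M^s(J_j)$ to a machine $M\in\mathcal{M}^s(J_j)$ holding fewer than $\mathrm{cap}(M)$ jobs (removing $M$ from its remaining set), or by moving a job with $\mathcal{M}^s(J_j)=\emptyset$,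 $M^s(J_j)\ne M_{m+1}$ to $M_{m+1}$. A state is reachable if it can be obtained from $0$ by finitely many successor steps. A state $t$ is subset-reachable from $s$ if every job $J_j$ satisfies one of: (a) $M^t(J_j)=M^s(J_j)$ and $\mathcal{M}^t(J_j)=\mathcal{M}^s(J_j)$; (b) $M^t(J_j)\in\mathcal{M}^s(J_j)$ and $\mathcal{M}^t(J_j)\subseteq\mathcal{M}^s(J_j)\setminus\{M^t(J_j)\}$; (c) $M^t(J_j)=M_{m+1}$ and $\mathcal{M}^t(J_j)=\emptyset$. -}

module Defs where

open import Data.Nat using (ℕ; _≤_; _<_)
open import Data.Bool using (Bool; true; false)
open import Data.Fin using (Fin)
import Data.Fin as F
open import Data.Fin.Subset using (Subset; _∈_; _∉_; _⊆_; _∪_; _─_; _-_; ⁅_⁆; ⊥)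
open import Data.Vec using (Vec; lookup; _[_]≔_; countᵇ; replicate)
open import Data.Product using (Σ; ∃; _×_; _,_)
open import Data.Sum using (_⊎_)
open import Relation.Binary.PropositionalEquality using (_≡_)
open import Relation.Nullary using (¬_; does)
open import Relation.Binary.Construct.Closure.ReflexiveTransitive using (Star)

-- Machines of a system with m real machines:
--   start = M_0, real i = M_{i+1} (i : Fin m), end = M_{m+1}.
data Mach (m : ℕ) : Set where
  start : Mach m
  real  : Fin m → Mach m
  end   : Mach m

record OpenShop (m n : ℕ) : Set where
  field
    cap     : Fin m → ℕ
    cap-pos : ∀ i → 1 ≤ cap i
    req     : Fin n → Subset m
open OpenShop public

record State (m n : ℕ) : Set where
  constructor mkState
  field
    pos : Vec (Mach m) n
    rem : Vec (Subset m) n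
open State public

isOn : ∀ {m} → Mach m → Fin m → Bool
isOn (real k) i = does (k F.≟ i)
isOn start    i = false
isOn end      i = false

load : ∀ {m n} → State m n → Fin m → ℕ
load s i = countᵇ (λ p → isOn p i) (pos s)

machSet : ∀ {m} → Mach m → Subset m
machSet (real i) = ⁅ i ⁆
machSet start    = ⊥
machSet end      = ⊥

ValidState : ∀ {m n} → OpenShop m n → State m n → Set
ValidState sys s =
  (∀ j i → lookup (pos s) j ≡ real i → i ∉ lookup (rem s) j)
  × (∀ i → load s i ≤ cap sys i)

initial : ∀ {m n} → OpenShop m n → State m n
initial {m} {n} sys = mkState (replicate n start) (Data.Vec.tabulate (req sys))

-- one successor step, where `sink` is the artificial machine jobs finish on
-- (end = M_{m+1} for the original system, start = M_0 for the reversed one)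
data StepTo {m n} (sys : OpenShop m n) (sink : Mach m) : State m n → State m n → Set where
  process : ∀ s j i →
    i ∈ lookup (rem s) j →
    load s i < cap sys i →
    StepTo sys sink s (mkState (pos s [ j ]≔ real i) (rem s [ j ]≔ (lookup (rem s) j - i)))
  finish : ∀ s j →
    lookup (rem s) j ≡ ⊥ →
    ¬ (lookup (pos s) j ≡ sink) →
    StepTo sys sink s (mkState (pos s [ j ]≔ sink) (rem s))

Reachable : ∀ {m n} → OpenShop m n → State m n → Set
Reachable sys s = Star (StepTo sys end) (initial sys) s

final-rev : ∀ {m n} → State m n
final-rev {m} {n} = mkState (replicate n start) (replicate n ⊥)

SafeReversed : ∀ {m n} → OpenShop m n → State m n → Set
SafeReversed sys t = Star (StepTo sys start) t final-rev

SubsetReachable : ∀ {m n} → State m n → State m n → Set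
SubsetReachable {m} {n} s t = ∀ (j : Fin n) →
    (lookup (pos t) j ≡ lookup (pos s) j × lookup (rem t) j ≡ lookup (rem s) j)
  ⊎ (Σ (Fin m) λ i → lookup (pos t) j ≡ real i × i ∈ lookup (rem s) j
        × lookup (rem t) j ⊆ (lookup (rem s) j - i))
  ⊎ (lookup (pos t) j ≡ end × lookup (rem t) j ≡ ⊥)

complementState : ∀ {m n} → OpenShop m n → State m n → State m n
complementState {m} {n} sys s = mkState (pos s)
  (Data.Vec.tabulate λ j → req sys j ─ (lookup (rem s) j ∪ machSet (lookup (pos s) j)))

module Submission where

-- Run the schedule backwards. Replace each remaining set by its complement
-- 𝓜(J) ∖ (𝓜^s(J) ∪ {M^s(J)}), the machines J has already passed through. If a job
-- moves from A to B in the original system, then between the complemented states it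
-- moves from B back to A in the reversed system; capacity is respected because it is
-- the job itself that has just vacated A. On states subset-reachable from 0 the
-- complement is an involution exchanging 0 with the reversed final state, so runs
-- 0 →* s and reversed runs t →* final correspond to each other.

open import Defs
open import Data.Nat using (ℕ; zero; suc; _+_; _≤_; _<_; z≤n)
open import Data.Nat.Properties using (+-comm; +-identityʳ; m≤m+n; ≤-reflexive; ≤-trans; <-≤-trans)
open import Data.Bool using (Bool; true; false)
open import Data.Fin using (Fin; zero; suc; _≟_)
open import Data.Fin.Subset using (Subset; _∈_; _∉_; _⊆_; _∪_; _─_; _-_; ⁅_⁆; ⊥)
open import Data.Fin.Subset.Properties
  using (_∈?_; ∉⊥; ⊥⊆; ⊆-refl; ⊆-trans; ⊆-antisym; x∈⁅x⁆; x∈⁅y⁆⇒x≡y; p⊆p∪q; q⊆p∪q; x∈p∪q⁻;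
         ∪-identityˡ; p─⊥≡p; p─q─r≡p─q∪r; p─q⊆p; x∈p∧x∉q⇒x∈p─q; x∈p∧x≢y⇒x∈p-y)
open import Data.Vec using (Vec; _∷_; [_]; here; there; lookup; _[_]≔_; countᵇ; replicate; tabulate)
open import Data.Vec.Properties
  using (lookup∘update; lookup∘update′; []≔-idempotent; []≔-lookup; lookup-replicate; lookup∘tabulate)
open import Data.Vec.Relation.Binary.Pointwise.Extensional using (ext; Pointwise-≡⇒≡)
open import Data.Product using (_×_; _,_; proj₂)
open import Data.Sum using (inj₁; inj₂)
open import Function using (_∘_)
open import Function.Bundles using (_⇔_; mk⇔)
open import Relation.Binary.PropositionalEquality hiding ([_])
open import Relation.Nullary using (yes; no; contradiction)
open import Relation.Nullary.Decidable using (dec-true; dec-false)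
open import Relation.Binary.Construct.Closure.ReflexiveTransitive using (Star; ε; _◅_; _◅◅_)

private
  variable
    m n : ℕ
    src snk A B : Mach m
    Q R R′ : Subset m

x∈p─q⁻ : ∀ {x : Fin n} (p q : Subset n) → x ∈ p ─ q → x ∈ p × x ∉ q
x∈p─q⁻ p q x∈p─q = p─q⊆p p q x∈p─q , x∉q q x∈p─q
  where
  x∉q : ∀ {n} {x : Fin n} {p} q → x ∈ p ─ q → x ∉ q
  x∉q {p = _ ∷ _} (_ ∷ _) ()            here
  x∉q {p = _ ∷ _} (_ ∷ q) (there x∈p─q) (there x∈q) = x∉q q x∈p─q x∈q

p⊆q⇒p─q≡⊥ : ∀ {p q : Subset n} → p ⊆ q → p ─ q ≡ ⊥
p⊆q⇒p─q≡⊥ {p = p} {q} p⊆q = ⊆-antisym empty ⊥⊆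
  where
  empty : p ─ q ⊆ ⊥
  empty x∈p─q = let x∈p , x∉q = x∈p─q⁻ p q x∈p─q in contradiction (p⊆q x∈p) x∉q

x∈p⇒p-x∪⁅x⁆≡p : ∀ {x : Fin n} {p} → x ∈ p → (p - x) ∪ ⁅ x ⁆ ≡ p
x∈p⇒p-x∪⁅x⁆≡p {x = x} {p} x∈p = ⊆-antisym ⊆p p⊆
  where
  ⊆p : (p - x) ∪ ⁅ x ⁆ ⊆ p
  ⊆p y∈ with x∈p∪q⁻ (p - x) ⁅ x ⁆ y∈
  ... | inj₁ y∈p-x = p─q⊆p p ⁅ x ⁆ y∈p-x
  ... | inj₂ y∈⁅x⁆ = subst (_∈ p) (sym (x∈⁅y⁆⇒x≡y x y∈⁅x⁆)) x∈p
  p⊆ : p ⊆ (p - x) ∪ ⁅ x ⁆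
  p⊆ {y} y∈p with y ≟ x
  ... | yes refl = q⊆p∪q (p - x) ⁅ x ⁆ (x∈⁅x⁆ x)
  ... | no y≢x   = p⊆p∪q ⁅ x ⁆ (x∈p∧x≢y⇒x∈p-y y∈p y≢x)

p─q∪r⊆p─r : ∀ (p q r : Subset n) → p ─ (q ∪ r) ⊆ p ─ r
p─q∪r⊆p─r p q r x∈ = let x∈p , x∉q∪r = x∈p─q⁻ p (q ∪ r) x∈ in
  x∈p∧x∉q⇒x∈p─q x∈p (x∉q∪r ∘ q⊆p∪q q r)

─-monoˡ-⊆ : ∀ {p q : Subset n} r → p ⊆ q → p ─ r ⊆ q ─ r
─-monoˡ-⊆ {p = p} r p⊆q x∈ = let x∈p , x∉r = x∈p─q⁻ p r x∈ in x∈p∧x∉q⇒x∈p─q (p⊆q x∈p) x∉r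

r⊆p─s⇒p─[p─[r∪s]∪s]≡r : ∀ {p r s : Subset n} → r ⊆ p ─ s → p ─ ((p ─ (r ∪ s)) ∪ s) ≡ r
r⊆p─s⇒p─[p─[r∪s]∪s]≡r {p = p} {r} {s} r⊆p─s = ⊆-antisym ⊆r r⊆
  where
  t : Subset _
  t = p ─ (r ∪ s)
  ⊆r : p ─ (t ∪ s) ⊆ r
  ⊆r {x} x∈ with x∈p─q⁻ p (t ∪ s) x∈ | x ∈? r
  ... | _           | yes x∈r = x∈r
  ... | x∈p , x∉t∪s | no  x∉r = contradiction (p⊆p∪q s (x∈p∧x∉q⇒x∈p─q x∈p x∉r∪s)) x∉t∪s
    where
    x∉r∪s : x ∉ r ∪ s
    x∉r∪s x∈r∪s with x∈p∪q⁻ r s x∈r∪s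
    ... | inj₁ x∈r = x∉r x∈r
    ... | inj₂ x∈s = x∉t∪s (q⊆p∪q t s x∈s)
  r⊆ : r ⊆ p ─ (t ∪ s)
  r⊆ {x} x∈r with x∈p─q⁻ p s (r⊆p─s x∈r)
  ... | x∈p , x∉s = x∈p∧x∉q⇒x∈p─q x∈p x∉t∪s
    where
    x∉t∪s : x ∉ t ∪ s
    x∉t∪s x∈t∪s with x∈p∪q⁻ t s x∈t∪s
    ... | inj₁ x∈t = proj₂ (x∈p─q⁻ p (r ∪ s) x∈t) (p⊆p∪q s x∈r)
    ... | inj₂ x∈s = x∉s x∈s

module _ {a} {X : Set a} (P : X → Bool) where

  countᵇ-[]≔ : ∀ (v : Vec X n) j b →
    countᵇ P (v [ j ]≔ b) + countᵇ P [ lookup v j ] ≡ countᵇ P v + countᵇ P [ b ]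
  countᵇ-[]≔ (x ∷ v) zero b with P x | P b
  ... | true  | true  = refl
  ... | false | false = refl
  ... | true  | false = trans (+-comm _ 1) (sym (+-identityʳ _))
  ... | false | true  = trans (+-identityʳ _) (+-comm 1 _)
  countᵇ-[]≔ (x ∷ v) (suc j) b with P x
  ... | true  = cong suc (countᵇ-[]≔ v j b)
  ... | false = countᵇ-[]≔ v j b

  countᵇ-[]≔-≤ : ∀ (v : Vec X n) j {b} → P b ≡ false → countᵇ P (v [ j ]≔ b) ≤ countᵇ P v
  countᵇ-[]≔-≤ v j {b} Pb with countᵇ-[]≔ v j b
  ... | eq rewrite Pb = ≤-trans (m≤m+n _ _) (≤-reflexive (trans eq (+-identityʳ _)))

  countᵇ-[]≔-≤-suc : ∀ (v : Vec X n) j {b} → P b ≡ true → countᵇ P (v [ j ]≔ b) ≤ suc (countᵇ P v)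
  countᵇ-[]≔-≤-suc v j {b} Pb with countᵇ-[]≔ v j b
  ... | eq rewrite Pb = ≤-trans (m≤m+n _ _) (≤-reflexive (trans eq (+-comm _ 1)))

  countᵇ-[]≔-< : ∀ (v : Vec X n) j {b} → P (lookup v j) ≡ true → P b ≡ false →
    countᵇ P (v [ j ]≔ b) < countᵇ P v
  countᵇ-[]≔-< v j {b} Pvj Pb with countᵇ-[]≔ v j b
  ... | eq rewrite Pvj | Pb = ≤-reflexive (trans (+-comm 1 _) (trans eq (+-identityʳ _)))

  countᵇ-replicate : ∀ n {x} → P x ≡ false → countᵇ P (replicate n x) ≡ 0
  countᵇ-replicate zero    Px = refl
  countᵇ-replicate (suc n) Px rewrite Px = countᵇ-replicate n Px

isOn-real : ∀ (a : Fin m) → isOn (real a) a ≡ true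
isOn-real a = dec-true (a ≟ a) refl

isOn⇒≡real : ∀ {A : Mach m} {a} → isOn A a ≡ true → A ≡ real a
isOn⇒≡real {A = real k} {a} on with k ≟ a
... | yes refl = refl
isOn⇒≡real {A = real k} () | no _

≢real⇒isOn≡false : ∀ {A : Mach m} {a} → A ≢ real a → isOn A a ≡ false
≢real⇒isOn≡false {A = real k} {a} A≢a = dec-false (k ≟ a) (A≢a ∘ cong real)
≢real⇒isOn≡false {A = start}      _   = refl
≢real⇒isOn≡false {A = end}        _   = refl

data Orientation {m} : Mach m → Mach m → Set where
  forward  : Orientation start end
  backward : Orientation end start

reverse : Orientation src snk → Orientation snk src
reverse forward  = backward
reverse backward = forward

machSet-source : Orientation src snk → machSet src ≡ ⊥
machSet-source forward  = refl
machSet-source backward = refl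

source≢real : Orientation src snk → ∀ {a} → src ≢ real a
source≢real forward  ()
source≢real backward ()

source≢sink : Orientation src snk → src ≢ snk
source≢sink forward  ()
source≢sink backward ()

-- Clauses (a)–(c) of subset-reachability from the initial state, read for jobs that
-- start on src and finish on snk.
data Phase {m} (src snk : Mach m) (Q : Subset m) : Mach m → Subset m → Set where
  waiting : Phase src snk Q src Q
  busy    : ∀ {a R} → a ∈ Q → R ⊆ Q - a → Phase src snk Q (real a) R
  done    : Phase src snk Q snk ⊥

complement : Subset m → Mach m → Subset m → Subset m
complement Q A R = Q ─ (R ∪ machSet A)

complement-waiting : ∀ A → complement Q A Q ≡ ⊥
complement-waiting A = p⊆q⇒p─q≡⊥ (p⊆p∪q (machSet A))

complement-done : ∀ A → machSet A ≡ ⊥ → complement Q A ⊥ ≡ Q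
complement-done {Q = Q} A A≡⊥ = begin
  Q ─ (⊥ ∪ machSet A) ≡⟨ cong (λ S → Q ─ (⊥ ∪ S)) A≡⊥ ⟩
  Q ─ (⊥ ∪ ⊥)         ≡⟨ cong (Q ─_) (∪-identityˡ ⊥) ⟩
  Q ─ ⊥               ≡⟨ p─⊥≡p Q ⟩
  Q                   ∎
  where open ≡-Reasoning

complement-process : ∀ {i} → i ∈ R → complement Q (real i) (R - i) ≡ Q ─ R
complement-process {Q = Q} i∈R = cong (Q ─_) (x∈p⇒p-x∪⁅x⁆≡p i∈R)

phase⇒⊆ : Orientation src snk → Phase src snk Q A R → R ⊆ Q ─ machSet A
phase⇒⊆ {Q = Q} o waiting rewrite machSet-source o | p─⊥≡p Q = ⊆-refl
phase⇒⊆ o (busy _ R⊆Q-a) = R⊆Q-a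
phase⇒⊆ o done = ⊥⊆

complement-involutive : Orientation src snk → Phase src snk Q A R → complement Q A (complement Q A R) ≡ R
complement-involutive o ph = r⊆p─s⇒p─[p─[r∪s]∪s]≡r (phase⇒⊆ o ph)

complement-phase : Orientation src snk → Phase src snk Q A R → Phase snk src Q A (complement Q A R)
complement-phase {src = src} o waiting = subst (Phase _ _ _ src) (sym (complement-waiting src)) done
complement-phase {Q = Q} {R = R} o (busy {a} a∈Q _) = busy a∈Q (p─q∪r⊆p─r Q R ⁅ a ⁆)
complement-phase {snk = snk} o done =
  subst (Phase _ _ _ snk) (sym (complement-done snk (machSet-source (reverse o)))) waiting

data JobMove {m} (sink : Mach m) : Mach m → Subset m → Mach m → Subset m → Set where
  process : ∀ {A R i R′} → i ∈ R → R′ ≡ R - i → JobMove sink A R (real i) R′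
  finish  : ∀ {A R R′} → A ≢ sink → R ≡ ⊥ → R′ ≡ ⊥ → JobMove sink A R sink R′

move-phase : Phase src snk Q A R → JobMove snk A R B R′ → Phase src snk Q B R′
move-phase waiting            (process i∈Q refl) = busy i∈Q ⊆-refl
move-phase {Q = Q} (busy {a} _ R⊆Q-a) (process {i = i} i∈R refl) =
  busy (p─q⊆p Q ⁅ a ⁆ (R⊆Q-a i∈R)) (─-monoˡ-⊆ ⁅ i ⁆ (⊆-trans R⊆Q-a (p─q⊆p Q ⁅ a ⁆)))
move-phase done               (process i∈⊥ _)    = contradiction i∈⊥ ∉⊥
move-phase _                  (finish _ _ refl)  = done

move-changes-machine : Orientation src snk → Phase src snk Q A R → JobMove snk A R B R′ → A ≢ B
move-changes-machine o waiting          (process _ _)     = source≢real o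
move-changes-machine {Q = Q} o (busy {a} _ R⊆Q-a) (process i∈R _) refl =
  proj₂ (x∈p─q⁻ Q ⁅ a ⁆ (R⊆Q-a i∈R)) (x∈⁅x⁆ a)
move-changes-machine o done             (process i∈⊥ _)   = contradiction i∈⊥ ∉⊥
move-changes-machine o _                (finish A≢snk _ _) = A≢snk

move-reverse : Orientation src snk → Phase src snk Q A R → JobMove snk A R B R′ →
  JobMove src B (complement Q B R′) A (complement Q A R)
move-reverse {src = src} o waiting (process i∈Q refl) =
  finish (source≢real o ∘ sym) (trans (complement-process i∈Q) (p⊆q⇒p─q≡⊥ ⊆-refl)) (complement-waiting src)
move-reverse {Q = Q} o (busy {a} {R} a∈Q R⊆Q-a) (process {i = i} i∈R refl) =
  process (subst (a ∈_) (sym (complement-process i∈R)) (x∈p∧x∉q⇒x∈p─q a∈Q a∉R)) (begin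
    Q ─ (R ∪ ⁅ a ⁆)                  ≡⟨ p─q─r≡p─q∪r Q R ⁅ a ⁆ ⟨
    Q ─ R - a                        ≡⟨ cong (_- a) (complement-process i∈R) ⟨
    complement Q (real i) (R - i) - a ∎)
  where
  open ≡-Reasoning
  a∉R : a ∉ R
  a∉R a∈R = proj₂ (x∈p─q⁻ Q ⁅ a ⁆ (R⊆Q-a a∈R)) (x∈⁅x⁆ a)
move-reverse o done (process i∈⊥ _) = contradiction i∈⊥ ∉⊥
move-reverse o waiting (finish _ refl refl) =
  finish (source≢sink o ∘ sym) (p⊆q⇒p─q≡⊥ ⊥⊆) (p⊆q⇒p─q≡⊥ ⊥⊆)
move-reverse {snk = snk} {Q = Q} o (busy {a} a∈Q _) (finish _ refl refl) =
  process (subst (a ∈_) (sym Q̄≡Q) a∈Q) (trans (cong (Q ─_) (∪-identityˡ ⁅ a ⁆)) (cong (_- a) (sym Q̄≡Q)))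
  where
  Q̄≡Q : complement Q snk ⊥ ≡ Q
  Q̄≡Q = complement-done snk (machSet-source (reverse o))
move-reverse o done (finish snk≢snk _ _) = contradiction refl snk≢snk

update : State m n → Fin n → Mach m → Subset m → State m n
update x j B R = mkState (pos x [ j ]≔ B) (rem x [ j ]≔ R)

[]≔-unchanged : ∀ {a} {X : Set a} (v : Vec X n) j {x} → lookup v j ≡ x → v [ j ]≔ x ≡ v
[]≔-unchanged v j vj≡x = trans (cong (v [ j ]≔_) (sym vj≡x)) ([]≔-lookup v j)

[]≔-restore : ∀ {a} {X : Set a} (v : Vec X n) j {x y} → lookup v j ≡ x → (v [ j ]≔ y) [ j ]≔ x ≡ v
[]≔-restore v j vj≡x = trans ([]≔-idempotent v j) ([]≔-unchanged v j vj≡x)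

update-restore : ∀ (x : State m n) j → lookup (pos x) j ≡ A → lookup (rem x) j ≡ R →
  update (update x j B R′) j A R ≡ x
update-restore x j posA remR = cong₂ mkState ([]≔-restore (pos x) j posA) ([]≔-restore (rem x) j remR)

Admits : OpenShop m n → State m n → Mach m → Set
Admits sys x B = ∀ i → B ≡ real i → load x i < cap sys i

WithinCapacity : OpenShop m n → State m n → Set
WithinCapacity sys x = ∀ i → load x i ≤ cap sys i

update-withinCapacity : ∀ {sys : OpenShop m n} x j →
  WithinCapacity sys x → Admits sys x B → WithinCapacity sys (update x j B R)
update-withinCapacity {B = B} x j bounded admits i with isOn B i in onB
... | true  = ≤-trans (countᵇ-[]≔-≤-suc (λ p → isOn p i) (pos x) j onB) (admits i (isOn⇒≡real onB))
... | false = ≤-trans (countᵇ-[]≔-≤ (λ p → isOn p i) (pos x) j onB) (bounded i)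

vacated-admits : ∀ {sys : OpenShop m n} x j → lookup (pos x) j ≡ A → A ≢ B →
  WithinCapacity sys x → Admits sys (update x j B R) A
vacated-admits {B = B} x j posA A≢B bounded i refl =
  <-≤-trans (countᵇ-[]≔-< (λ p → isOn p i) (pos x) j onA (≢real⇒isOn≡false (A≢B ∘ sym))) (bounded i)
  where
  onA : isOn (lookup (pos x) j) i ≡ true
  onA = trans (cong (λ p → isOn p i) posA) (isOn-real i)

data Move {m n} (sys : OpenShop m n) (sink : Mach m) (x : State m n) : State m n → Set where
  move : ∀ j {B R} → JobMove sink (lookup (pos x) j) (lookup (rem x) j) B R → Admits sys x B →
         Move sys sink x (update x j B R)

-- A finish step is not checked against capacities, so the sink has to be artificial.
stepTo⇒move : ∀ {sys : OpenShop m n} {sink x y} → (∀ {i} → sink ≢ real i) →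
  StepTo sys sink x y → Move sys sink x y
stepTo⇒move _ (process x j i i∈R load<cap) = move j (process i∈R refl) λ { _ refl → load<cap }
stepTo⇒move {sys = sys} {sink} sink≢real (finish x j R≡⊥ A≢sink) =
  subst (Move sys sink x) (cong (mkState _) ([]≔-lookup (rem x) j))
        (move j (finish A≢sink R≡⊥ R≡⊥) λ _ sink≡i → contradiction sink≡i sink≢real)

move⇒stepTo : ∀ {sys : OpenShop m n} {sink x y} → Move sys sink x y → StepTo sys sink x y
move⇒stepTo (move j (process i∈R refl) admits) = process _ j _ i∈R (admits _ refl)
move⇒stepTo {sys = sys} {sink} {x} (move j (finish A≢sink R≡⊥ R′≡⊥) _) =
  subst (StepTo sys sink x) (cong (mkState _) (sym ([]≔-unchanged (rem x) j (trans R≡⊥ (sym R′≡⊥)))))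
        (finish x j R≡⊥ A≢sink)

rem-complementState : ∀ (sys : OpenShop m n) x j →
  lookup (rem (complementState sys x)) j ≡ complement (req sys j) (lookup (pos x) j) (lookup (rem x) j)
rem-complementState sys x j = lookup∘tabulate _ j

complementState-update : ∀ (sys : OpenShop m n) x j B R →
  complementState sys (update x j B R) ≡ update (complementState sys x) j B (complement (req sys j) B R)
complementState-update sys x j B R = cong (mkState _) (Pointwise-≡⇒≡ (ext agree))
  where
  open ≡-Reasoning
  agree : ∀ k → lookup (rem (complementState sys (update x j B R))) k
              ≡ lookup (rem (complementState sys x) [ j ]≔ complement (req sys j) B R) k
  agree k with j ≟ k
  ... | yes refl = begin
    lookup (rem (complementState sys (update x j B R))) j
      ≡⟨ rem-complementState sys (update x j B R) j ⟩
    complement (req sys j) (lookup (pos x [ j ]≔ B) j) (lookup (rem x [ j ]≔ R) j)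
      ≡⟨ cong₂ (complement (req sys j)) (lookup∘update j (pos x) B) (lookup∘update j (rem x) R) ⟩
    complement (req sys j) B R
      ≡⟨ lookup∘update j (rem (complementState sys x)) _ ⟨
    lookup (rem (complementState sys x) [ j ]≔ complement (req sys j) B R) j ∎
  ... | no j≢k = begin
    lookup (rem (complementState sys (update x j B R))) k
      ≡⟨ rem-complementState sys (update x j B R) k ⟩
    complement (req sys k) (lookup (pos x [ j ]≔ B) k) (lookup (rem x [ j ]≔ R) k)
      ≡⟨ cong₂ (complement (req sys k)) (lookup∘update′ k≢j (pos x) B) (lookup∘update′ k≢j (rem x) R) ⟩
    complement (req sys k) (lookup (pos x) k) (lookup (rem x) k)
      ≡⟨ rem-complementState sys x k ⟨
    lookup (rem (complementState sys x)) k
      ≡⟨ lookup∘update′ k≢j (rem (complementState sys x)) _ ⟨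
    lookup (rem (complementState sys x) [ j ]≔ complement (req sys j) B R) k ∎
    where
    k≢j : k ≢ j
    k≢j = j≢k ∘ sym

Phases : OpenShop m n → Mach m → Mach m → State m n → Set
Phases sys src snk x = ∀ j → Phase src snk (req sys j) (lookup (pos x) j) (lookup (rem x) j)

update-phases : ∀ {sys : OpenShop m n} x j → Phases sys src snk x →
  Phase src snk (req sys j) B R → Phases sys src snk (update x j B R)
update-phases {src = src} {snk} {B} {R} {sys = sys} x j phases phase k with j ≟ k
... | yes refl = subst₂ (Phase src snk (req sys j))
                        (sym (lookup∘update j (pos x) B)) (sym (lookup∘update j (rem x) R)) phase
... | no j≢k   = subst₂ (Phase src snk (req sys k))
                        (sym (lookup∘update′ (j≢k ∘ sym) (pos x) B))
                        (sym (lookup∘update′ (j≢k ∘ sym) (rem x) R)) (phases k)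

record Consistent (sys : OpenShop m n) (src snk : Mach m) (x : State m n) : Set where
  field
    withinCapacity : WithinCapacity sys x
    phases         : Phases sys src snk x
open Consistent

reverse-step : ∀ {sys : OpenShop m n} {x y} → Orientation src snk →
  Consistent sys src snk x → Move sys snk x y →
  Consistent sys src snk y × Move sys src (complementState sys y) (complementState sys x)
reverse-step {src = src} {snk} {sys = sys} {x} o c (move j {B} {R′} jm admits) =
  c′ , subst₂ (Move sys src) x̄′≡ x̄≡ back
  where
  Qj : Subset _
  Qj = req sys j
  Aj : Mach _
  Aj = lookup (pos x) j
  Rj : Subset _
  Rj = lookup (rem x) j
  ph : Phase src snk Qj Aj Rj
  ph = phases c j
  c′ : Consistent sys src snk (update x j B R′)
  c′ = record
    { withinCapacity = update-withinCapacity {R = R′} {sys = sys} x j (withinCapacity c) admits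
    ; phases         = update-phases {sys = sys} x j (phases c) (move-phase ph jm)
    }
  x̄ x̄′ : State _ _
  x̄ = complementState sys x
  x̄′ = update x̄ j B (complement Qj B R′)
  jm′ : JobMove src (lookup (pos x̄′) j) (lookup (rem x̄′) j) Aj (complement Qj Aj Rj)
  jm′ = subst₂ (λ B′ R̄′ → JobMove src B′ R̄′ Aj (complement Qj Aj Rj))
          (sym (lookup∘update j (pos x) B)) (sym (lookup∘update j (rem x̄) _)) (move-reverse o ph jm)
  back : Move sys src x̄′ (update x̄′ j Aj (complement Qj Aj Rj))
  back = move j jm′ (vacated-admits {R = complement Qj B R′} {sys = sys} x̄ j refl
                       (move-changes-machine o ph jm) (withinCapacity c))
  x̄′≡ : x̄′ ≡ complementState sys (update x j B R′)
  x̄′≡ = sym (complementState-update sys x j B R′)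
  x̄≡ : update x̄′ j Aj (complement Qj Aj Rj) ≡ x̄
  x̄≡ = update-restore x̄ j refl (rem-complementState sys x j)

reverse-run : ∀ {sys : OpenShop m n} {x z} → Orientation src snk → Consistent sys src snk x →
  Star (StepTo sys snk) x z → Star (StepTo sys src) (complementState sys z) (complementState sys x)
reverse-run o c ε = ε
reverse-run o c (step ◅ steps) with reverse-step o c (stepTo⇒move (source≢real (reverse o)) step)
... | c′ , back = reverse-run o c′ steps ◅◅ (move⇒stepTo back ◅ ε)

subsetReachable⇒phases : ∀ (sys : OpenShop m n) s → SubsetReachable (initial sys) s → Phases sys start end s
subsetReachable⇒phases sys s reach j with reach j
... | inj₁ (pos≡ , rem≡) rewrite lookup∘tabulate (req sys) j =
  subst₂ (Phase start end (req sys j)) (sym (trans pos≡ (lookup-replicate j start))) (sym rem≡) waiting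
... | inj₂ (inj₁ (i , pos≡ , i∈ , rem⊆)) rewrite lookup∘tabulate (req sys) j =
  subst (λ A → Phase start end (req sys j) A (lookup (rem s) j)) (sym pos≡) (busy i∈ rem⊆)
... | inj₂ (inj₂ (pos≡ , rem≡)) = subst₂ (Phase start end (req sys j)) (sym pos≡) (sym rem≡) done

initial-consistent : ∀ (sys : OpenShop m n) → Consistent sys start end (initial sys)
initial-consistent {n = n} sys = record
  { withinCapacity = λ i → subst (_≤ cap sys i) (sym (countᵇ-replicate (λ p → isOn p i) n refl)) z≤n
  ; phases         = subsetReachable⇒phases sys (initial sys) (λ _ → inj₁ (refl , refl))
  }

complementState-consistent : ∀ {sys : OpenShop m n} {x} → Orientation src snk →
  Consistent sys src snk x → Consistent sys snk src (complementState sys x)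
complementState-consistent {sys = sys} {x} o c = record
  { withinCapacity = withinCapacity c
  ; phases         = λ j → subst (Phase _ _ (req sys j) (lookup (pos x) j)) (sym (rem-complementState sys x j))
                                 (complement-phase o (phases c j))
  }

complementState-involutive : ∀ {sys : OpenShop m n} {x} → Orientation src snk →
  Consistent sys src snk x → complementState sys (complementState sys x) ≡ x
complementState-involutive {sys = sys} {x} o c = cong (mkState (pos x)) (Pointwise-≡⇒≡ (ext λ j →
  trans (rem-complementState sys (complementState sys x) j)
        (trans (cong (complement (req sys j) (lookup (pos x) j)) (rem-complementState sys x j))
               (complement-involutive o (phases c j)))))

complementState-initial : ∀ (sys : OpenShop m n) → complementState sys (initial sys) ≡ final-rev
complementState-initial {n = n} sys = cong (mkState _) (Pointwise-≡⇒≡ (ext λ j → begin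
  lookup (rem (complementState sys (initial sys))) j
    ≡⟨ rem-complementState sys (initial sys) j ⟩
  complement (req sys j) (lookup (replicate n start) j) (lookup (tabulate (req sys)) j)
    ≡⟨ cong₂ (complement (req sys j)) (lookup-replicate j start) (lookup∘tabulate (req sys) j) ⟩
  complement (req sys j) start (req sys j)
    ≡⟨ complement-waiting start ⟩
  ⊥
    ≡⟨ lookup-replicate j ⊥ ⟨
  lookup (replicate n ⊥) j ∎))
  where open ≡-Reasoning

complementState-final-rev : ∀ (sys : OpenShop m n) → complementState sys final-rev ≡ initial sys
complementState-final-rev {n = n} sys = cong (mkState _) (Pointwise-≡⇒≡ (ext λ j → begin
  lookup (rem (complementState sys final-rev)) j
    ≡⟨ rem-complementState sys final-rev j ⟩
  complement (req sys j) (lookup (replicate n start) j) (lookup (replicate n ⊥) j)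
    ≡⟨ cong₂ (complement (req sys j)) (lookup-replicate j start) (lookup-replicate j ⊥) ⟩
  complement (req sys j) start ⊥
    ≡⟨ complement-done start refl ⟩
  req sys j
    ≡⟨ lookup∘tabulate (req sys) j ⟨
  lookup (tabulate (req sys)) j ∎))
  where open ≡-Reasoning

-- M^s(J) ∉ 𝓜^s(J), the first half of validity, already follows from subset-reachability.
lemma4p2 : ∀ {m n} (sys : OpenShop m n) (s : State m n) →
    ValidState sys s →
    SubsetReachable (initial sys) s →
    (Reachable sys s ⇔ SafeReversed sys (complementState sys s))
lemma4p2 sys s (_ , withinCapacity) reach = mk⇔ reachable⇒safe safe⇒reachable
  where
  consistent : Consistent sys start end s
  consistent = record { withinCapacity = withinCapacity ; phases = subsetReachable⇒phases sys s reach }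
  reachable⇒safe : Reachable sys s → SafeReversed sys (complementState sys s)
  reachable⇒safe run = subst (Star (StepTo sys start) (complementState sys s)) (complementState-initial sys)
                             (reverse-run forward (initial-consistent sys) run)
  safe⇒reachable : SafeReversed sys (complementState sys s) → Reachable sys s
  safe⇒reachable run = subst₂ (Star (StepTo sys end)) (complementState-final-rev sys)
                              (complementState-involutive forward consistent)
                              (reverse-run backward (complementState-consistent forward consistent) run)
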